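{- Let $A$ be any AnyFit strategy for the online two-dimensional vector packing problem. Then there exists an input sequence $\sigma$ such that $$|A(\sigma)|\geq \frac{11}{5}\,|\mathrm{OPT}(\sigma)|.$$
   Context: Online two-dimensional vector packing: an input sequence $\sigma=(v_1,v_2,\ldots)$ of vectors $v_i\in[0,1]^2$ is revealed one vector at a time. Each vector must be irrevocably assigned, before the next one arrives, either to an already opened bin or to a newly opened bin. A set of vectors $B$ forms a feasible bin if $\|\sum_{v\in B} v\|_\infty\le 1$, i.e. the coordinate-wise sums are at most $1$. $A(\sigma)$ denotes the packing (set of bins) produced by strategy $A$ on $\sigma$, and $\mathrm{OPT}(\sigma)$ is a packing of the vectors of $\sigma$ into the minimum possible number of feasible bins. An online strategy is an AnyFit strategy if it never opens a new bin unless the current vector does not fit (feasibly) into any already opened bin. -}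

module Defs where

open import Data.Nat using (ℕ; zero; suc) renaming (_≤_ to _≤ℕ_; _<_ to _<ℕ_)
open import Data.Rational using (ℚ; 0ℚ; 1ℚ; _+_; _≤_)
open import Data.Product using (_×_; _,_; proj₁; proj₂)
open import Data.Sum using (_⊎_)
open import Data.List using (List; []; _∷_; _++_; [_]; foldl; length; lookup; concat)
open import Data.List.Relation.Unary.All using (All)
open import Data.Fin using (fromℕ<)
open import Relation.Nullary using (¬_)

V2 : Set
V2 = ℚ × ℚ

InUnitSquare : V2 → Set
InUnitSquare (x , y) = (0ℚ ≤ x × x ≤ 1ℚ) × (0ℚ ≤ y × y ≤ 1ℚ)

load : List V2 → V2
load [] = (0ℚ , 0ℚ)
load ((x , y) ∷ b) = (x + proj₁ (load b) , y + proj₂ (load b))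

-- ‖ Σ_{v ∈ B} v ‖_∞ ≤ 1   (coordinates are nonnegative for valid inputs)
FeasibleBin : List V2 → Set
FeasibleBin b = (proj₁ (load b) ≤ 1ℚ) × (proj₂ (load b) ≤ 1ℚ)

Fits : V2 → List V2 → Set
Fits v b = FeasibleBin (v ∷ b)

-- A deterministic online strategy: given the previously revealed vectors
-- (in arrival order) and the current vector, it returns the index of the
-- bin to put the current vector in; an index ≥ number of open bins means
-- "open a new bin".  (For a deterministic strategy its own past decisions
-- are a function of the past vectors, so this is fully general.)
record Strategy : Set where
  field
    choose : List V2 → V2 → ℕ
open Strategy public

place : List (List V2) → ℕ → V2 → List (List V2)
place [] i v = [ v ] ∷ []
place (b ∷ bs) zero v = (v ∷ b) ∷ bs
place (b ∷ bs) (suc i) v = b ∷ place bs i v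

step : Strategy → List V2 × List (List V2) → V2 → List V2 × List (List V2)
step A (hist , bs) v = (hist ++ [ v ] , place bs (choose A hist v) v)

run : Strategy → List V2 → List (List V2)
run A σ = proj₂ (foldl (step A) ([] , []) σ)

IsAnyFit : Strategy → Set
IsAnyFit A =
  ∀ (hist : List V2) (v : V2) → All InUnitSquare hist → InUnitSquare v →
    let bs = run A hist
        i  = choose A hist v
    in (Data.Product.Σ (i <ℕ length bs) λ p → Fits v (lookup bs (fromℕ< p)))
       ⊎ ((length bs ≤ℕ i) × All (λ b → ¬ Fits v b) bs)

open import Data.List.Relation.Binary.Permutation.Propositional using (_↭_)

PackingOf : List V2 → List (List V2) → Set
PackingOf σ bins = (concat bins ↭ σ) × All FeasibleBin bins

-- The nineteen vectors of σ are chosen so that, at each arrival, the new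
-- vector fits into at most one of the bins opened so far.  An AnyFit strategy
-- therefore has no choice at any step: whatever it is, it produces the same
-- packing, which has 11 bins, whereas σ can be packed into 5 bins.
module Submission where

open import Defs
open import Data.Nat using (ℕ; _*_; _≤_)
open import Data.Product using (Σ; _×_)
open import Data.List using (List; _∷_; length)
open import Data.List.Relation.Unary.All using (All)

open import Data.Nat using (zero; suc; _<_; z≤n; s≤s)
open import Data.Nat.Properties using (≤-reflexive)
open import Data.Integer using (+_)
open import Data.Rational using (0ℚ; 1ℚ; _/_; _≤?_)
open import Data.Rational.Properties using (≤-decTotalOrder)
open import Data.Product using (_,_; proj₁; proj₂)
open import Data.Product.Relation.Binary.Lex.NonStrict using (×-decTotalOrder)
open import Data.Sum using (_⊎_; inj₁; inj₂)
open import Data.Maybe using (Maybe; just; nothing; _>>=_)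
open import Data.List using ([]; _++_; [_]; foldl; lookup; concat)
open import Data.List.Properties using (foldl-++; ++-assoc; ++-identityʳ)
open import Data.List.Membership.Propositional.Properties using (∈-lookup)
open import Data.List.Relation.Unary.All using ([]; _∷_; all?)
import Data.List.Relation.Unary.All as All
open import Data.List.Relation.Unary.All.Properties using (++⁺)
open import Data.List.Relation.Binary.Permutation.Propositional using (_↭_; ↭-trans; ↭-sym)
open import Data.List.Sort.Base using (SortingAlgorithm)
open import Data.List.Sort.MergeSort (×-decTotalOrder ≤-decTotalOrder ≤-decTotalOrder)
  using (mergeSort)
open import Data.Fin using (fromℕ<)
open import Data.Empty using (⊥-elim)
open import Relation.Nullary using (¬_; Dec; yes; no)
open import Relation.Nullary.Decidable using (_×-dec_; toWitness)
open import Relation.Binary.PropositionalEquality using (_≡_; refl; sym; trans; cong; module ≡-Reasoning)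

open SortingAlgorithm mergeSort using (sort-↭)

feasible? : (b : List V2) → Dec (FeasibleBin b)
feasible? b = (proj₁ (load b) ≤? 1ℚ) ×-dec (proj₂ (load b) ≤? 1ℚ)

fits? : (v : V2) (b : List V2) → Dec (Fits v b)
fits? v b = feasible? (v ∷ b)

inUnitSquare? : (v : V2) → Dec (InUnitSquare v)
inUnitSquare? (x , y) =
  ((0ℚ ≤? x) ×-dec (x ≤? 1ℚ)) ×-dec ((0ℚ ≤? y) ×-dec (y ≤? 1ℚ))

FitsAt : V2 → List (List V2) → ℕ → Set
FitsAt v bs i = Σ (i < length bs) λ p → Fits v (lookup bs (fromℕ< p))

FitsNowhere : V2 → List (List V2) → Set
FitsNowhere v bs = All (λ b → ¬ Fits v b) bs

AnyFitChoice : V2 → List (List V2) → ℕ → Set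
AnyFitChoice v bs i = FitsAt v bs i ⊎ ((length bs ≤ i) × FitsNowhere v bs)

fitsNowhere⇒¬fitsAt : ∀ {v bs i} → FitsNowhere v bs → ¬ FitsAt v bs i
fitsNowhere⇒¬fitsAt nowhere (p , fits) = All.lookup nowhere (∈-lookup (fromℕ< p)) fits

place-≥ : ∀ bs {i} v → length bs ≤ i → place bs i v ≡ bs ++ [ [ v ] ]
place-≥ []       v _         = refl
place-≥ (b ∷ bs) v (s≤s len≤i) = cong (b ∷_) (place-≥ bs v len≤i)

data ForcedSlot (v : V2) (bs : List (List V2)) : Set where
  new  : FitsNowhere v bs → ForcedSlot v bs
  only : ∀ k → FitsAt v bs k → (∀ {j} → FitsAt v bs j → j ≡ k) → ForcedSlot v bs

forcedSlot? : ∀ v bs → Maybe (ForcedSlot v bs)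
forcedSlot? v [] = just (new [])
forcedSlot? v (b ∷ bs) with fits? v b | forcedSlot? v bs
... | yes fits | just (new nowhere) = just (only 0 (s≤s z≤n , fits) onlyHead)
  where
  onlyHead : ∀ {j} → FitsAt v (b ∷ bs) j → j ≡ 0
  onlyHead {zero}  _              = refl
  onlyHead {suc j} (s≤s p , fits′) = ⊥-elim (fitsNowhere⇒¬fitsAt {v} {bs} nowhere (p , fits′))
... | yes _    | _                     = nothing
... | no ¬fits | just (new nowhere)    = just (new (¬fits ∷ nowhere))
... | no ¬fits | just (only k (p , fits) unique) =
  just (only (suc k) (s≤s p , fits) onlyTail)
  where
  onlyTail : ∀ {j} → FitsAt v (b ∷ bs) j → j ≡ suc k
  onlyTail {zero}  (_ , fits′)     = ⊥-elim (¬fits fits′)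
  onlyTail {suc j} (s≤s q , fits′) = cong suc (unique (q , fits′))
... | no _     | nothing               = nothing

placeForced : ∀ {v bs} → ForcedSlot v bs → List (List V2)
placeForced {v} {bs} (new _)      = bs ++ [ [ v ] ]
placeForced {v} {bs} (only k _ _) = place bs k v

place-forced : ∀ {v bs i} (s : ForcedSlot v bs) → AnyFitChoice v bs i →
               place bs i v ≡ placeForced s
place-forced {v} {bs} (new nowhere)     (inj₁ fitsAt)        =
  ⊥-elim (fitsNowhere⇒¬fitsAt {v} {bs} nowhere fitsAt)
place-forced {v} {bs} (new _)           (inj₂ (len≤i , _))    = place-≥ bs v len≤i
place-forced {v} {bs} (only k _ unique) (inj₁ fitsAt)        = cong (λ j → place bs j v) (unique fitsAt)
place-forced {v} {bs} (only k fitsAt _) (inj₂ (_ , nowhere)) =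
  ⊥-elim (fitsNowhere⇒¬fitsAt {v} {bs} nowhere fitsAt)

forcedRun : List (List V2) → List V2 → Maybe (List (List V2))
forcedRun bs []       = just bs
forcedRun bs (v ∷ vs) = forcedSlot? v bs >>= λ s → forcedRun (placeForced s) vs

foldl-step-proj₁ : ∀ A hist bs vs → proj₁ (foldl (step A) (hist , bs) vs) ≡ hist ++ vs
foldl-step-proj₁ A hist bs []       = sym (++-identityʳ hist)
foldl-step-proj₁ A hist bs (v ∷ vs) = trans (foldl-step-proj₁ A (hist ++ [ v ]) _ vs) (++-assoc hist [ v ] vs)

run-snoc : ∀ A hist v → run A (hist ++ [ v ]) ≡ place (run A hist) (choose A hist v) v
run-snoc A hist v = begin
  proj₂ (foldl (step A) ([] , []) (hist ++ [ v ]))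
    ≡⟨ cong proj₂ (foldl-++ (step A) ([] , []) hist [ v ]) ⟩
  proj₂ (step A (foldl (step A) ([] , []) hist) v)
    ≡⟨ cong (λ h → place (run A hist) (choose A h v) v) (foldl-step-proj₁ A [] [] hist) ⟩
  place (run A hist) (choose A hist v) v ∎
  where open ≡-Reasoning

run-forced : ∀ A → IsAnyFit A → ∀ hist vs {r} →
             All InUnitSquare hist → All InUnitSquare vs →
             forcedRun (run A hist) vs ≡ just r → run A (hist ++ vs) ≡ r
run-forced A anyFit hist [] valid _ refl = cong (run A) (++-identityʳ hist)
run-forced A anyFit hist (v ∷ vs) valid (valid-v ∷ valid-vs) forced
  with forcedSlot? v (run A hist)
... | just s =
  trans (cong (run A) (sym (++-assoc hist [ v ] vs)))
        (run-forced A anyFit (hist ++ [ v ]) vs (++⁺ valid (valid-v ∷ [])) valid-vs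
          (trans (cong (λ bs → forcedRun bs vs) run-step) forced))
  where
  run-step : run A (hist ++ [ v ]) ≡ placeForced s
  run-step = trans (run-snoc A hist v) (place-forced s (anyFit hist v valid valid-v))
run-forced A anyFit hist (v ∷ vs) valid (valid-v ∷ valid-vs) () | nothing

⟨_,_⟩ : ℕ → ℕ → V2
⟨ x , y ⟩ = (+ x / 60 , + y / 60)

σ : List V2
σ = ⟨ 3 , 21 ⟩ ∷ ⟨ 0 , 2 ⟩ ∷ ⟨ 3 , 19 ⟩ ∷ ⟨ 0 , 18 ⟩ ∷ ⟨ 23 , 8 ⟩ ∷ ⟨ 19 , 24 ⟩ ∷
    ⟨ 0 , 30 ⟩ ∷ ⟨ 1 , 30 ⟩ ∷ ⟨ 24 , 26 ⟩ ∷ ⟨ 21 , 5 ⟩ ∷ ⟨ 4 , 30 ⟩ ∷ ⟨ 27 , 2 ⟩ ∷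
    ⟨ 1 , 30 ⟩ ∷ ⟨ 1 , 30 ⟩ ∷ ⟨ 33 , 1 ⟩ ∷ ⟨ 35 , 1 ⟩ ∷ ⟨ 31 , 3 ⟩ ∷ ⟨ 30 , 6 ⟩ ∷
    ⟨ 32 , 10 ⟩ ∷ []

σ-anyFitPacking : List (List V2)
σ-anyFitPacking =
  (⟨ 0 , 18 ⟩ ∷ ⟨ 3 , 19 ⟩ ∷ ⟨ 0 , 2 ⟩ ∷ ⟨ 3 , 21 ⟩ ∷ []) ∷
  (⟨ 19 , 24 ⟩ ∷ ⟨ 23 , 8 ⟩ ∷ []) ∷
  (⟨ 1 , 30 ⟩ ∷ ⟨ 0 , 30 ⟩ ∷ []) ∷
  (⟨ 21 , 5 ⟩ ∷ ⟨ 24 , 26 ⟩ ∷ []) ∷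
  (⟨ 27 , 2 ⟩ ∷ ⟨ 4 , 30 ⟩ ∷ []) ∷
  (⟨ 1 , 30 ⟩ ∷ ⟨ 1 , 30 ⟩ ∷ []) ∷
  [ ⟨ 33 , 1 ⟩ ] ∷ [ ⟨ 35 , 1 ⟩ ] ∷ [ ⟨ 31 , 3 ⟩ ] ∷ [ ⟨ 30 , 6 ⟩ ] ∷ [ ⟨ 32 , 10 ⟩ ] ∷ []

σ-optimalPacking : List (List V2)
σ-optimalPacking =
  (⟨ 3 , 21 ⟩ ∷ ⟨ 23 , 8 ⟩ ∷ ⟨ 1 , 30 ⟩ ∷ ⟨ 33 , 1 ⟩ ∷ []) ∷
  (⟨ 0 , 2 ⟩ ∷ ⟨ 19 , 24 ⟩ ∷ ⟨ 0 , 30 ⟩ ∷ ⟨ 35 , 1 ⟩ ∷ []) ∷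
  (⟨ 1 , 30 ⟩ ∷ ⟨ 24 , 26 ⟩ ∷ ⟨ 31 , 3 ⟩ ∷ []) ∷
  (⟨ 3 , 19 ⟩ ∷ ⟨ 21 , 5 ⟩ ∷ ⟨ 4 , 30 ⟩ ∷ ⟨ 30 , 6 ⟩ ∷ []) ∷
  (⟨ 0 , 18 ⟩ ∷ ⟨ 27 , 2 ⟩ ∷ ⟨ 1 , 30 ⟩ ∷ ⟨ 32 , 10 ⟩ ∷ []) ∷ []

σ-valid : All InUnitSquare σ
σ-valid = toWitness {a? = all? inUnitSquare? σ} _

σ-forcedRun : forcedRun [] σ ≡ just σ-anyFitPacking
σ-forcedRun = refl

-- Both sides sort (by merge sort, lexicographically) to the same list.
σ-optimalPacking-↭ : concat σ-optimalPacking ↭ σ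
σ-optimalPacking-↭ = ↭-trans (↭-sym (sort-↭ (concat σ-optimalPacking))) (sort-↭ σ)

σ-optimalPacking-feasible : All FeasibleBin σ-optimalPacking
σ-optimalPacking-feasible = toWitness {a? = all? feasible? σ-optimalPacking} _

theorem1 : (A : Strategy) → IsAnyFit A →
    Σ V2 λ v → Σ (List V2) λ τ → All InUnitSquare (v ∷ τ) ×
      Σ (List (List V2)) λ opt → PackingOf (v ∷ τ) opt ×
        11 * length opt ≤ 5 * length (run A (v ∷ τ))
theorem1 A anyFit =
  ⟨ 3 , 21 ⟩ , _ , σ-valid , σ-optimalPacking ,
  (σ-optimalPacking-↭ , σ-optimalPacking-feasible) ,
  ≤-reflexive (cong (λ bins → 5 * length bins) (sym run≡))
  where
  run≡ : run A σ ≡ σ-anyFitPacking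
  run≡ = run-forced A anyFit [] σ [] σ-valid σ-forcedRun
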